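{- Let $T$ be the monad on $\mathbf{Set}$ with $TX=\mathbb{N}\times X$, unit $\eta_X(x)=(0,x)$ and multiplication $\mu_X(n,(m,x))=(n+m,x)$. Its Eilenberg–Moore category $\mathscr{C}$ is the category of sets with one unary operation $u$ (no equations), where on $TX$ one has $u(n,x)=(n+1,x)$. Let $F=\mathrm{Id}$ on $\mathscr{C}$. Let $E$ be the set of equivalence classes of eventually periodic streams of natural numbers, equipped with the unary operation $\mathrm{id}_E$ and the $\mathrm{Id}$-coalgebra structure $\mathrm{id}_E$. For every $\mathrm{Id}$-coalgebra $(TX,\gamma_X)$ with $X$ finite, define $\gamma_X^\sharp\colon TX\to E$ by sending $(m,x)$ to the class of the stream generated by $x$. Then these maps form a colimit cocone, in the category of $\mathrm{Id}$-coalgebras on $\mathscr{C}$, of the diagram of all $\mathrm{Id}$-coalgebras with ffg carrier. In particular, $\phi\,\mathrm{Id}$ is carried by $E$.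
   Context: ffg objects. An ffg object of $\mathscr{C}$ is one isomorphic to $TX$ with $X$ a finite set. Streams generated by a coalgebra. An $\mathrm{Id}$-coalgebra $\gamma_X\colon TX\to TX$ in $\mathscr{C}$ (with $X$ finite) is determined by its restriction to generators, written $x\mapsto\gamma_X(0,x)=(o(x),\delta(x))\in\mathbb{N}\times X$. The stream generated by $x\in X$ is $(o(x),o(\delta(x)),o(\delta^2(x)),\ldots)$. It is eventually periodic, i.e. of the form $s_0s_1^\omega$ for finite lists $s_0,s_1$ of natural numbers with $s_1$ nonempty. Equivalence. Two eventually periodic streams $s=s_0s_1^\omega$ and $t=t_0t_1^\omega$, with $s_1=(s_{1,0},\ldots,s_{1,p-1})$ and $t_1=(t_{1,0},\ldots,t_{1,q-1})$, are equivalent if $q\cdot\sum_{i<p}s_{1,i}=p\cdot\sum_{j<q}t_{1,j}$. This does not depend on the chosen representations. The fixed point. $\phi\,\mathrm{Id}$ denotes the colimit, in the category of $\mathrm{Id}$-coalgebras on $\mathscr{C}$, of all $\mathrm{Id}$-coalgebras whose carrier is an ffg object. -}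

module Defs where

open import Data.Nat using (ℕ; zero; suc; _+_; _*_; _∸_; _<_; _≤_; z≤n; s≤s)
open import Data.Nat.Properties using (n<1+n; m+[n∸m]≡n; +-assoc; +-comm; <⇒≤; m<n⇒0<n∸m)
open import Data.Fin using (Fin; toℕ)
import Data.Fin.Properties as FinP
open import Data.Product using (Σ; _×_; _,_; proj₁; proj₂)
open import Relation.Binary.PropositionalEquality

T : Set → Set
T X = ℕ × X

uT : {X : Set} → T X → T X
uT (n , x) = (suc n , x)

IsUHom : {A B : Set} → (A → A) → (B → B) → (A → B) → Set
IsUHom uA uB f = ∀ a → f (uA a) ≡ uB (f a)

-- The diagram of Id-coalgebras with ffg carrier T X, X finite (X = Fin n).
-- An Id-coalgebra on the C-object (T (Fin n), uT) is a C-endomorphism γ.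

Obj : Set
Obj = Σ ℕ λ n → Σ (T (Fin n) → T (Fin n)) λ γ → IsUHom uT uT γ

Car : Obj → Set
Car (n , _) = T (Fin n)

str : (o : Obj) → Car o → Car o
str (n , γ , _) = γ

Hom : Obj → Obj → Set
Hom o o′ = Σ (Car o → Car o′) λ h →
  IsUHom uT uT h × (∀ t → h (str o t) ≡ str o′ (h t))

-- Eventually periodic streams of naturals: a stream s of the form s₀ s₁^ω
-- with |s₀| = pre and |s₁| = per > 0, i.e. s (pre + t + per) = s (pre + t).

record EPStream : Set where
  field
    stream   : ℕ → ℕ
    pre      : ℕ
    per      : ℕ
    per>0    : 0 < per
    periodic : ∀ t → stream (pre + t + per) ≡ stream (pre + t)
open EPStream public

sumFrom : (ℕ → ℕ) → ℕ → ℕ → ℕ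
sumFrom f k zero    = 0
sumFrom f k (suc p) = f k + sumFrom f (suc k) p

periodSum : EPStream → ℕ
periodSum s = sumFrom (stream s) (pre s) (per s)

-- equivalence of eventually periodic streams; E is the quotient of
-- EPStream by this relation (represented as a setoid).
_≈E_ : EPStream → EPStream → Set
s ≈E t = per t * periodSum s ≡ per s * periodSum t

iter : {A : Set} → (A → A) → ℕ → A → A
iter f zero    a = a
iter f (suc m) a = iter f m (f a)

iter-+ : {A : Set} (f : A → A) (a b : ℕ) (x : A) → iter f (a + b) x ≡ iter f b (iter f a x)
iter-+ f zero    b x = refl
iter-+ f (suc a) b x = iter-+ f a b (f x)

module _ {n : ℕ} (γ : T (Fin n) → T (Fin n)) where
  outG : Fin n → ℕ
  outG x = proj₁ (γ (0 , x))

  nextG : Fin n → Fin n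
  nextG x = proj₂ (γ (0 , x))

  genStream : Fin n → ℕ → ℕ
  genStream x i = outG (iter nextG i x)

  private
    periodicityOf : (x : Fin n) →
      Σ ℕ λ k → Σ ℕ λ p → (0 < p) × (iter nextG (k + p) x ≡ iter nextG k x)
    periodicityOf x with FinP.pigeonhole (n<1+n n) (λ (i : Fin (suc n)) → iter nextG (toℕ i) x)
    ... | i , j , i<j , eq =
      toℕ i , toℕ j ∸ toℕ i , m<n⇒0<n∸m i<j ,
      trans (cong (λ m → iter nextG m x) (m+[n∸m]≡n (<⇒≤ i<j))) (sym eq)

  genEP : Fin n → EPStream
  genEP x with periodicityOf x
  ... | k , p , p>0 , eq = record
    { stream = genStream x ; pre = k ; per = p ; per>0 = p>0
    ; periodic = λ t → cong outG (begin
        iter nextG (k + t + p) x   ≡⟨ cong (λ m → iter nextG m x) (trans (+-assoc k t p) (trans (cong (k +_) (+-comm t p)) (sym (+-assoc k p t)))) ⟩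
        iter nextG (k + p + t) x   ≡⟨ iter-+ nextG (k + p) t x ⟩
        iter nextG t (iter nextG (k + p) x) ≡⟨ cong (iter nextG t) eq ⟩
        iter nextG t (iter nextG k x) ≡⟨ sym (iter-+ nextG k t x) ⟩
        iter nextG (k + t) x ∎) }
    where open ≡-Reasoning

sharp : (o : Obj) → Car o → EPStream
sharp (n , γ , _) (m , x) = genEP γ x

uE : EPStream → EPStream
uE e = e

cE : EPStream → EPStream
cE e = e

-- A generator of a coalgebra on T X, X finite, lies on a lasso: a tail followed
-- by a cycle. A coalgebra morphism sends the orbit of x to the orbit of its image,
-- shifting levels by an eventually periodic lag; telescoping over a common period
-- shows that the mean output per step, periodSum / per, is preserved, so the γ♯
-- form a cocone. Conversely, every point of the diagram is joined by a zigzag of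
-- morphisms to a canonical cycle of some length p emitting (0, …, 0, S), and the
-- canonical cycles for (p , S) and (q , T) are joined whenever q S = p T, since
-- both unroll to cycles of length p q. So the connected components of the
-- diagram, i.e. its colimit, are exactly the ≈E-classes.
module Submission where

open import Defs
open import Data.Nat
open import Data.Nat.Properties
open import Data.Nat.DivMod
  using (_%_; _/_; _mod_; m≡m%n+[m/n]*n; [m+n]%n≡m%n; [m+kn]%n≡m%n; n%n≡0; m*n%n≡0; m<n⇒m%n≡m)
open import Data.Nat.Tactic.RingSolver using (solve-∀)
open import Data.Fin using (Fin; toℕ; zero)
import Data.Fin.Properties as FinP
open import Data.Product using (Σ; _×_; _,_; proj₁; proj₂)
open import Relation.Nullary using (yes; no; contradiction)
open import Relation.Binary.Structures using (IsEquivalence)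
open import Relation.Binary.Construct.Closure.Equivalence as EqClosure using (EqClosure; gfold)
open import Relation.Binary.PropositionalEquality
open ≡-Reasoning

sumFrom-+ : ∀ f k m n → sumFrom f k (m + n) ≡ sumFrom f k m + sumFrom f (k + m) n
sumFrom-+ f k zero    n = cong (λ j → sumFrom f j n) (sym (+-identityʳ k))
sumFrom-+ f k (suc m) n = begin
  f k + sumFrom f (suc k) (m + n)                        ≡⟨ cong (f k +_) (sumFrom-+ f (suc k) m n) ⟩
  f k + (sumFrom f (suc k) m + sumFrom f (suc k + m) n)  ≡⟨ sym (+-assoc (f k) _ _) ⟩
  f k + sumFrom f (suc k) m + sumFrom f (suc k + m) n    ≡⟨ cong (λ j → f k + sumFrom f (suc k) m + sumFrom f j n) (sym (+-suc k m)) ⟩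
  f k + sumFrom f (suc k) m + sumFrom f (k + suc m) n    ∎

sumFrom-snoc : ∀ f k n → sumFrom f k (suc n) ≡ sumFrom f k n + f (k + n)
sumFrom-snoc f k n = begin
  sumFrom f k (suc n)              ≡⟨ cong (sumFrom f k) (+-comm 1 n) ⟩
  sumFrom f k (n + 1)              ≡⟨ sumFrom-+ f k n 1 ⟩
  sumFrom f k n + (f (k + n) + 0)  ≡⟨ cong (sumFrom f k n +_) (+-identityʳ _) ⟩
  sumFrom f k n + f (k + n)        ∎

sumFrom-cong : ∀ {f g} k n → (∀ i → k ≤ i → i < k + n → f i ≡ g i) → sumFrom f k n ≡ sumFrom g k n
sumFrom-cong k zero    eq = refl
sumFrom-cong k (suc n) eq = cong₂ _+_
  (eq k ≤-refl (m<m+n k z<s))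
  (sumFrom-cong (suc k) n λ i k<i i<k+n → eq i (<⇒≤ k<i) (subst (i <_) (sym (+-suc k n)) i<k+n))

sumFrom-telescope : ∀ (f g a : ℕ → ℕ) → (∀ i → g i + a i ≡ f i + a (suc i)) →
  ∀ k L → sumFrom g k L + a k ≡ sumFrom f k L + a (k + L)
sumFrom-telescope f g a step k zero    = cong a (sym (+-identityʳ k))
sumFrom-telescope f g a step k (suc L) = begin
  g k + sumFrom g (suc k) L + a k        ≡⟨ swap (g k) _ (a k) ⟩
  (g k + a k) + sumFrom g (suc k) L      ≡⟨ cong (_+ sumFrom g (suc k) L) (step k) ⟩
  (f k + a (suc k)) + sumFrom g (suc k) L ≡⟨ swap′ (f k) (a (suc k)) _ ⟩
  f k + (sumFrom g (suc k) L + a (suc k)) ≡⟨ cong (f k +_) (sumFrom-telescope f g a step (suc k) L) ⟩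
  f k + (sumFrom f (suc k) L + a (suc k + L)) ≡⟨ sym (+-assoc (f k) _ _) ⟩
  f k + sumFrom f (suc k) L + a (suc k + L)   ≡⟨ cong (λ j → f k + sumFrom f (suc k) L + a j) (sym (+-suc k L)) ⟩
  f k + sumFrom f (suc k) L + a (k + suc L)   ∎
  where
  swap : ∀ x y z → x + y + z ≡ (x + z) + y
  swap = solve-∀
  swap′ : ∀ x y z → (x + y) + z ≡ x + (z + y)
  swap′ = solve-∀

PeriodicFrom : {A : Set} → (ℕ → A) → ℕ → ℕ → Set
PeriodicFrom f K p = ∀ j → f (K + j + p) ≡ f (K + j)

module _ {A : Set} (f : ℕ → A) {K p : ℕ} (periodic : PeriodicFrom f K p) where

  periodicFrom-≤ : ∀ {k} → K ≤ k → f (k + p) ≡ f k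
  periodicFrom-≤ K≤k = subst (λ k → f (k + p) ≡ f k) (m+[n∸m]≡n K≤k) (periodic _)

  periodicFrom-* : ∀ {k} → K ≤ k → ∀ q → f (k + q * p) ≡ f k
  periodicFrom-* {k} K≤k zero    = cong f (+-identityʳ k)
  periodicFrom-* {k} K≤k (suc q) = begin
    f (k + (p + q * p))  ≡⟨ cong f (sym (+-assoc k p (q * p))) ⟩
    f (k + p + q * p)    ≡⟨ periodicFrom-* (≤-trans K≤k (m≤m+n k p)) q ⟩
    f (k + p)            ≡⟨ periodicFrom-≤ K≤k ⟩
    f k                  ∎

module _ (f : ℕ → ℕ) {K p : ℕ} (periodic : PeriodicFrom f K p) where

  sumFrom-window : ∀ {k} → K ≤ k → sumFrom f k p ≡ sumFrom f K p
  sumFrom-window K≤k = subst (λ k → sumFrom f k p ≡ sumFrom f K p) (m+[n∸m]≡n K≤k) (shifted (_ ∸ K))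
    where
    slide : ∀ k → f (k + p) ≡ f k → sumFrom f (suc k) p ≡ sumFrom f k p
    slide k fk+p≡fk = +-cancelʳ-≡ (f k) _ _ (begin
      sumFrom f (suc k) p + f k  ≡⟨ +-comm _ (f k) ⟩
      sumFrom f k (suc p)        ≡⟨ sumFrom-snoc f k p ⟩
      sumFrom f k p + f (k + p)  ≡⟨ cong (sumFrom f k p +_) fk+p≡fk ⟩
      sumFrom f k p + f k        ∎)
    shifted : ∀ j → sumFrom f (K + j) p ≡ sumFrom f K p
    shifted zero    = cong (λ k → sumFrom f k p) (+-identityʳ K)
    shifted (suc j) = begin
      sumFrom f (K + suc j) p    ≡⟨ cong (λ k → sumFrom f k p) (+-suc K j) ⟩
      sumFrom f (suc (K + j)) p  ≡⟨ slide (K + j) (periodic j) ⟩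
      sumFrom f (K + j) p        ≡⟨ shifted j ⟩
      sumFrom f K p              ∎

  sumFrom-periodic : ∀ {k} → K ≤ k → ∀ q → sumFrom f k (q * p) ≡ q * sumFrom f K p
  sumFrom-periodic         K≤k zero    = refl
  sumFrom-periodic {k = k} K≤k (suc q) = begin
    sumFrom f k (p + q * p)                        ≡⟨ sumFrom-+ f k p (q * p) ⟩
    sumFrom f k p + sumFrom f (k + p) (q * p)      ≡⟨ cong₂ _+_ (sumFrom-window K≤k)
                                                        (sumFrom-periodic (≤-trans K≤k (m≤m+n k p)) q) ⟩
    sumFrom f K p + q * sumFrom f K p              ∎

iter-suc : ∀ {A : Set} (f : A → A) n x → iter f (suc n) x ≡ f (iter f n x)
iter-suc f n x = trans (cong (λ m → iter f m x) (+-comm 1 n)) (iter-+ f n 1 x)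

iter-periodicFrom : ∀ {A : Set} (f : A → A) {x k p} →
  iter f (k + p) x ≡ iter f k x → PeriodicFrom (λ i → iter f i x) k p
iter-periodicFrom f {x} {k} {p} closes j = begin
  iter f (k + j + p) x            ≡⟨ cong (λ m → iter f m x) (+-exchange k j p) ⟩
  iter f (k + p + j) x            ≡⟨ iter-+ f (k + p) j x ⟩
  iter f j (iter f (k + p) x)     ≡⟨ cong (iter f j) closes ⟩
  iter f j (iter f k x)           ≡⟨ sym (iter-+ f k j x) ⟩
  iter f (k + j) x                ∎
  where
  +-exchange : ∀ a b c → a + b + c ≡ a + c + b
  +-exchange = solve-∀

iter-% : ∀ {A : Set} (f : A → A) {x} N .{{_ : NonZero N}} → iter f N x ≡ x →
  ∀ r → iter f (r % N) x ≡ iter f r x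
iter-% f {x} N closes r = begin
  iter f (r % N) x              ≡⟨ sym (periodicFrom-* (λ i → iter f i x) (iter-periodicFrom f {k = 0} {p = N} closes) {r % N} z≤n (r / N)) ⟩
  iter f (r % N + r / N * N) x  ≡⟨ cong (λ m → iter f m x) (sym (m≡m%n+[m/n]*n r N)) ⟩
  iter f r x                    ∎

iter-eventuallyPeriodic : ∀ {n} (f : Fin n → Fin n) (x : Fin n) →
  Σ ℕ λ K → Σ ℕ λ p → 0 < p × PeriodicFrom (λ i → iter f i x) K p
iter-eventuallyPeriodic {n} f x
  with FinP.pigeonhole (n<1+n n) (λ (i : Fin (suc n)) → iter f (toℕ i) x)
... | i , j , i<j , eq = toℕ i , toℕ j ∸ toℕ i , m<n⇒0<n∸m i<j ,
  iter-periodicFrom f {x} {toℕ i} (trans (cong (λ m → iter f m x) (m+[n∸m]≡n (<⇒≤ i<j))) (sym eq))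

iter-commute : ∀ {A B : Set} {f : A → A} {g : B → B} (h : A → B) →
  (∀ z → h (f z) ≡ g (h z)) → ∀ i z → iter g i (h z) ≡ h (iter f i z)
iter-commute h comm zero    z = refl
iter-commute h comm (suc i) z = trans (cong (iter _ i) (sym (comm z))) (iter-commute h comm i _)

≈E-trans : ∀ {s t u} → s ≈E t → t ≈E u → s ≈E u
≈E-trans {s} {t} {u} s≈t t≈u = *-cancelˡ-≡ _ _ (per t) {{>-nonZero (per>0 t)}} (begin
  per t * (per u * periodSum s)  ≡⟨ *-exchange (per t) (per u) _ ⟩
  per u * (per t * periodSum s)  ≡⟨ cong (per u *_) s≈t ⟩
  per u * (per s * periodSum t)  ≡⟨ *-exchange (per u) (per s) _ ⟩
  per s * (per u * periodSum t)  ≡⟨ cong (per s *_) t≈u ⟩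
  per s * (per t * periodSum u)  ≡⟨ *-exchange (per s) (per t) _ ⟩
  per t * (per s * periodSum u)  ∎)
  where
  *-exchange : ∀ x y z → x * (y * z) ≡ y * (x * z)
  *-exchange = solve-∀

≈E-isEquivalence : IsEquivalence _≈E_
≈E-isEquivalence = record { refl = refl ; sym = sym ; trans = λ {s} {t} {u} → ≈E-trans {s} {t} {u} }

≈E-per-periodSum : ∀ {s t} → per s ≡ per t → periodSum s ≡ periodSum t → s ≈E t
≈E-per-periodSum per≡ sum≡ = cong₂ _*_ (sym per≡) sum≡

-- Summing the relation over a common multiple L of the three periods, far
-- enough out, the correction terms a cancel, and both sides become multiples
-- of the period sums.
≈E-telescope : ∀ (s t : EPStream) (a : ℕ → ℕ) {K P} → 0 < P → PeriodicFrom a K P →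
  (∀ i → stream s i + a i ≡ stream t i + a (suc i)) → s ≈E t
≈E-telescope s t a {K} {P} P>0 a-periodic step =
  *-cancelˡ-≡ _ _ P {{>-nonZero P>0}} (begin
    P * (per t * periodSum s)       ≡⟨ rearrange P (per t) _ ⟩
    (per t * P) * periodSum s       ≡⟨ sym sum-s ⟩
    sumFrom (stream s) k L          ≡⟨ +-cancelʳ-≡ (a k) _ _ telescoped ⟩
    sumFrom (stream t) k L          ≡⟨ sum-t ⟩
    (per s * P) * periodSum t       ≡⟨ sym (rearrange P (per s) _) ⟩
    P * (per s * periodSum t)       ∎)
  where
  k = K + pre s + pre t
  L = (per t * P) * per s
  rearrange : ∀ x y z → x * (y * z) ≡ (y * x) * z
  rearrange = solve-∀
  swap-outer : ∀ x y z → (x * y) * z ≡ (z * y) * x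
  swap-outer = solve-∀
  swap-inner : ∀ x y z → (x * y) * z ≡ (x * z) * y
  swap-inner = solve-∀
  L-via-t : L ≡ (per s * P) * per t
  L-via-t = swap-outer (per t) P (per s)
  L-via-a : L ≡ (per t * per s) * P
  L-via-a = swap-inner (per t) P (per s)
  sum-s : sumFrom (stream s) k L ≡ (per t * P) * periodSum s
  sum-s = sumFrom-periodic (stream s) (periodic s) (≤-trans (m≤n+m (pre s) K) (m≤m+n _ (pre t))) (per t * P)
  sum-t : sumFrom (stream t) k L ≡ (per s * P) * periodSum t
  sum-t = trans (cong (sumFrom (stream t) k) L-via-t)
                (sumFrom-periodic (stream t) (periodic t) (m≤n+m (pre t) _) (per s * P))
  telescoped : sumFrom (stream s) k L + a k ≡ sumFrom (stream t) k L + a k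
  telescoped = begin
    sumFrom (stream s) k L + a k                       ≡⟨ sumFrom-telescope (stream t) (stream s) a step k L ⟩
    sumFrom (stream t) k L + a (k + L)                 ≡⟨ cong (λ j → sumFrom (stream t) k L + a (k + j)) L-via-a ⟩
    sumFrom (stream t) k L + a (k + per t * per s * P) ≡⟨ cong (sumFrom (stream t) k L +_)
                                                          (periodicFrom-* a a-periodic K≤k (per t * per s)) ⟩
    sumFrom (stream t) k L + a k                       ∎
    where K≤k = ≤-trans (m≤m+n K (pre s)) (m≤m+n _ (pre t))

≈E-pointwise : ∀ s t → (∀ i → stream s i ≡ stream t i) → s ≈E t
≈E-pointwise s t s≗t = ≈E-telescope s t (λ _ → 0) {0} {1} z<s (λ _ → refl) (λ i → cong (_+ 0) (s≗t i))

uHom-unfold : ∀ {X Y : Set} (g : T X → T Y) → IsUHom uT uT g → ∀ m x →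
  g (m , x) ≡ (m + proj₁ (g (0 , x)) , proj₂ (g (0 , x)))
uHom-unfold g g-hom zero    x = refl
uHom-unfold g g-hom (suc m) x = trans (g-hom (m , x)) (cong uT (uHom-unfold g g-hom m x))

uT-hom : (o : Obj) → Hom o o
uT-hom (n , γ , γ-hom) = uT , (λ _ → refl) , λ t → sym (γ-hom t)

str-hom : (o : Obj) → Hom o o
str-hom (n , γ , γ-hom) = γ , γ-hom , λ _ → refl

sharp-hom : (o o′ : Obj) (h : Hom o o′) (t : Car o) → sharp o′ (proj₁ h t) ≈E sharp o t
sharp-hom (n , γ , _) (n′ , γ′ , γ′-hom) (h , h-hom , h-square) (m , x)
  with iter-eventuallyPeriodic (nextG γ) x
... | K , P , P>0 , orbit-periodic =
  subst (λ y → genEP γ′ y ≈E genEP γ x) (sym (cong proj₂ (uHom-unfold h h-hom m x)))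
    (≈E-telescope (genEP γ′ (image x)) (genEP γ x) (λ i → lag (orbit i)) {K} P>0
      (λ j → cong lag (orbit-periodic j)) step)
  where
  orbit : ℕ → Fin n
  orbit i = iter (nextG γ) i x
  lag : Fin n → ℕ
  lag z = proj₁ (h (0 , z))
  image : Fin n → Fin n′
  image z = proj₂ (h (0 , z))
  square : ∀ z → (outG γ z + lag (nextG γ z) , image (nextG γ z))
               ≡ (lag z + outG γ′ (image z) , nextG γ′ (image z))
  square z = begin
    (outG γ z + lag (nextG γ z) , image (nextG γ z))   ≡⟨ sym (uHom-unfold h h-hom _ _) ⟩
    h (γ (0 , z))                                      ≡⟨ h-square (0 , z) ⟩
    γ′ (h (0 , z))                                     ≡⟨ uHom-unfold γ′ γ′-hom _ _ ⟩
    (lag z + outG γ′ (image z) , nextG γ′ (image z))   ∎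
  image-orbit : ∀ i → iter (nextG γ′) i (image x) ≡ image (orbit i)
  image-orbit i = iter-commute image (λ z → cong proj₂ (square z)) i x
  step : ∀ i → genStream γ′ (image x) i + lag (orbit i) ≡ genStream γ x i + lag (orbit (suc i))
  step i = begin
    outG γ′ (iter (nextG γ′) i (image x)) + lag (orbit i)  ≡⟨ cong (λ y → outG γ′ y + lag (orbit i)) (image-orbit i) ⟩
    outG γ′ (image (orbit i)) + lag (orbit i)              ≡⟨ +-comm (outG γ′ (image (orbit i))) _ ⟩
    lag (orbit i) + outG γ′ (image (orbit i))              ≡⟨ sym (cong proj₁ (square (orbit i))) ⟩
    outG γ (orbit i) + lag (nextG γ (orbit i))             ≡⟨ cong (λ z → outG γ (orbit i) + lag z) (sym (iter-suc (nextG γ) i x)) ⟩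
    outG γ (orbit i) + lag (orbit (suc i))                 ∎

Point : Set
Point = Σ Obj Car

sharp′ : Point → EPStream
sharp′ (o , t) = sharp o t

data _⟶_ : Point → Point → Set where
  along : ∀ {o o′ t} (h : Hom o o′) → (o , t) ⟶ (o′ , proj₁ h t)

-- The colimit of the diagram, computed in sets, is Point modulo this relation.
_∼_ : Point → Point → Set
_∼_ = EqClosure _⟶_

open IsEquivalence (EqClosure.isEquivalence _⟶_)
  using () renaming (refl to ∼-refl; sym to ∼-sym; trans to ∼-trans; reflexive to ≡⇒∼)

∼-hom : ∀ o o′ (h : Hom o o′) t → (o , t) ∼ (o′ , proj₁ h t)
∼-hom _ _ h t = EqClosure.return (along h)

sharp-∼ : ∀ {x y} → x ∼ y → sharp′ x ≈E sharp′ y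
sharp-∼ = gfold ≈E-isEquivalence sharp′ λ { (along {o} {o′} {t} h) → sym (sharp-hom o o′ h t) }

∼-drop : ∀ o m y → (o , (m , y)) ∼ (o , (0 , y))
∼-drop o zero    y = ∼-refl
∼-drop o (suc m) y = ∼-trans (∼-sym (∼-hom o o (uT-hom o) (m , y))) (∼-drop o m y)

∼-iter : ∀ {n γ γ-hom} j y →
  ((n , γ , γ-hom) , (0 , y)) ∼ ((n , γ , γ-hom) , (0 , iter (nextG γ) j y))
∼-iter zero    y = ∼-refl
∼-iter {n} {γ} {γ-hom} (suc j) y =
  ∼-trans (∼-hom o o (str-hom o) (0 , y)) (∼-trans (∼-drop o (outG γ y) (nextG γ y)) (∼-iter j (nextG γ y)))
  where o = (n , γ , γ-hom)

next : ∀ {p₀} → Fin (suc p₀) → Fin (suc p₀)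
next {p₀} i = suc (toℕ i) mod suc p₀

cycle : ℕ → (ℕ → ℕ) → Obj
cycle p₀ c = suc p₀ , (λ (m , i) → (m + c (toℕ i) , next i)) , λ _ → refl

toℕ-next : ∀ {p₀} (i : Fin (suc p₀)) → toℕ (next i) ≡ suc (toℕ i) % suc p₀
toℕ-next i = FinP.toℕ-fromℕ< _

toℕ-iter-next : ∀ p₀ j → toℕ (iter (next {p₀}) j zero) ≡ j % suc p₀
toℕ-iter-next p₀ zero    = refl
toℕ-iter-next p₀ (suc j) = begin
  toℕ (iter next (suc j) zero)      ≡⟨ cong toℕ (iter-suc next j zero) ⟩
  toℕ (next (iter next j zero))     ≡⟨ toℕ-next (iter next j zero) ⟩
  suc (toℕ (iter next j zero)) % p  ≡⟨ cong (λ r → suc r % p) (toℕ-iter-next p₀ j) ⟩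
  suc (j % p) % p                   ≡⟨ sym ([m+kn]%n≡m%n (suc (j % p)) (j / p) p) ⟩
  suc (j % p + j / p * p) % p       ≡⟨ cong (λ r → suc r % p) (sym (m≡m%n+[m/n]*n j p)) ⟩
  suc j % p                         ∎
  where p = suc p₀

iter-next-closes : ∀ p₀ r → r % suc p₀ ≡ 0 → iter (next {p₀}) r zero ≡ zero
iter-next-closes p₀ r r%p≡0 = FinP.toℕ-injective (trans (toℕ-iter-next p₀ r) r%p≡0)

cyclicStream : ℕ → (ℕ → ℕ) → EPStream
cyclicStream p₀ c = record
  { stream = λ j → c (j % suc p₀) ; pre = 0 ; per = suc p₀ ; per>0 = z<s
  ; periodic = λ t → cong c ([m+n]%n≡m%n t (suc p₀)) }

periodSum-cyclicStream : ∀ p₀ c → periodSum (cyclicStream p₀ c) ≡ sumFrom c 0 (suc p₀)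
periodSum-cyclicStream p₀ c = sumFrom-cong 0 (suc p₀) λ i _ i<p → cong c (m<n⇒m%n≡m i<p)

sharp-cycle : ∀ p₀ c m → sharp (cycle p₀ c) (m , zero) ≈E cyclicStream p₀ c
sharp-cycle p₀ c m = ≈E-pointwise (sharp (cycle p₀ c) (m , zero)) (cyclicStream p₀ c) λ j → cong c (toℕ-iter-next p₀ j)

cycleHom : ∀ p₀ c {n γ} (γ-hom : IsUHom uT uT γ) (x : Fin n) (a : ℕ → ℕ) →
  iter (nextG γ) (suc p₀) x ≡ x →
  (∀ j → j < suc p₀ → c j + a (suc j % suc p₀) ≡ a j + outG γ (iter (nextG γ) j x)) →
  Hom (cycle p₀ c) (n , γ , γ-hom)
cycleHom p₀ c {n} {γ} γ-hom x a closes step = h , (λ _ → refl) , square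
  where
  δ = nextG γ
  h : T (Fin (suc p₀)) → T (Fin n)
  h (m , i) = (m + a (toℕ i) , iter δ (toℕ i) x)
  square : ∀ t → h (str (cycle p₀ c) t) ≡ γ (h t)
  square (m , i) = begin
    (m + c (toℕ i) + a (toℕ (next i)) , iter δ (toℕ (next i)) x)
      ≡⟨ cong₂ _,_ (cong (λ r → m + c (toℕ i) + a r) (toℕ-next i)) (cong (λ r → iter δ r x) (toℕ-next i)) ⟩
    (m + c (toℕ i) + a (suc (toℕ i) % suc p₀) , iter δ (suc (toℕ i) % suc p₀) x)
      ≡⟨ cong₂ _,_ (trans (+-assoc m _ _) (cong (m +_) (step (toℕ i) (FinP.toℕ<n i))))
                   (trans (iter-% δ {x} (suc p₀) closes (suc (toℕ i))) (iter-suc δ (toℕ i) x)) ⟩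
    (m + (a (toℕ i) + outG γ (iter δ (toℕ i) x)) , δ (iter δ (toℕ i) x))
      ≡⟨ cong (_, δ (iter δ (toℕ i) x)) (sym (+-assoc m _ _)) ⟩
    (m + a (toℕ i) + outG γ (iter δ (toℕ i) x) , δ (iter δ (toℕ i) x))
      ≡⟨ sym (uHom-unfold γ γ-hom _ _) ⟩
    γ (h (m , i)) ∎

unrollHom : ∀ q₀ p₀ c → Hom (cycle (p₀ + q₀ * suc p₀) (λ j → c (j % suc p₀))) (cycle p₀ c)
unrollHom q₀ p₀ c = cycleHom _ _ {γ = str (cycle p₀ c)} (λ _ → refl) zero (λ _ → 0)
  (iter-next-closes p₀ (suc q₀ * suc p₀) (m*n%n≡0 (suc q₀) (suc p₀)))
  (λ j _ → trans (+-identityʳ _) (cong c (sym (toℕ-iter-next p₀ j))))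

orbitHom : ∀ {n γ} (γ-hom : IsUHom uT uT γ) (x : Fin n) K P₀ →
  PeriodicFrom (λ i → iter (nextG γ) i x) K (suc P₀) →
  Hom (cycle P₀ (λ j → genStream γ x (K + j))) (n , γ , γ-hom)
orbitHom {γ = γ} γ-hom x K P₀ periodic = cycleHom _ _ γ-hom (iter δ K x) (λ _ → 0)
  (trans (sym (iter-+ δ K (suc P₀) x)) (periodicFrom-≤ (λ i → iter δ i x) {K} periodic ≤-refl))
  (λ j _ → trans (+-identityʳ _) (cong (outG γ) (iter-+ δ K j x)))
  where δ = nextG γ

atLast : ℕ → ℕ → ℕ → ℕ
atLast p S j with suc j ≟ p
... | yes _ = S
... | no  _ = 0

atLast-< : ∀ {p S j} → suc j < p → atLast p S j ≡ 0
atLast-< {p} {S} {j} j+1<p with suc j ≟ p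
... | yes j+1≡p = contradiction j+1≡p (<⇒≢ j+1<p)
... | no  _     = refl

atLast-≡ : ∀ {p S j} → suc j ≡ p → atLast p S j ≡ S
atLast-≡ {p} {S} {j} j+1≡p with suc j ≟ p
... | yes _     = refl
... | no  j+1≢p = contradiction j+1≡p j+1≢p

sumFrom-atLast : ∀ p₀ S → sumFrom (atLast (suc p₀) S) 0 (suc p₀) ≡ S
sumFrom-atLast p₀ S = begin
  sumFrom (atLast p S) 0 (suc p₀)                ≡⟨ sumFrom-snoc (atLast p S) 0 p₀ ⟩
  sumFrom (atLast p S) 0 p₀ + atLast p S p₀      ≡⟨ cong₂ _+_ (before 0 p₀ ≤-refl) (atLast-≡ refl) ⟩
  S                                              ∎
  where
  p = suc p₀
  before : ∀ k n → k + n < p → sumFrom (atLast p S) k n ≡ 0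
  before k zero    _     = refl
  before k (suc n) k+n<p = cong₂ _+_
    (atLast-< (≤-<-trans (s≤s (m≤m+n k n)) (subst (_< p) (+-suc k n) k+n<p)))
    (before (suc k) n (subst (_< p) (+-suc k n) k+n<p))

canonical : ℕ → ℕ → Obj
canonical p₀ S = cycle p₀ (atLast (suc p₀) S)

canonicalStream : ℕ → ℕ → EPStream
canonicalStream p₀ S = cyclicStream p₀ (atLast (suc p₀) S)

periodSum-canonicalStream : ∀ p₀ S → periodSum (canonicalStream p₀ S) ≡ S
periodSum-canonicalStream p₀ S = trans (periodSum-cyclicStream p₀ _) (sumFrom-atLast p₀ S)

canonicalHom : ∀ p₀ c → Hom (canonical p₀ (sumFrom c 0 (suc p₀))) (cycle p₀ c)
canonicalHom p₀ c = cycleHom _ _ {γ = str (cycle p₀ c)} (λ _ → refl) zero (sumFrom c 0)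
  (iter-next-closes p₀ p (n%n≡0 p))
  (λ j j<p → begin
    atLast p S j + sumFrom c 0 (suc j % p)   ≡⟨ partial j j<p ⟩
    sumFrom c 0 (suc j)                      ≡⟨ sumFrom-snoc c 0 j ⟩
    sumFrom c 0 j + c j                      ≡⟨ cong (λ r → sumFrom c 0 j + c r)
                                                  (sym (trans (toℕ-iter-next p₀ j) (m<n⇒m%n≡m j<p))) ⟩
    sumFrom c 0 j + c (toℕ (iter next j zero)) ∎)
  where
  p = suc p₀
  S = sumFrom c 0 p
  partial : ∀ j → j < p → atLast p S j + sumFrom c 0 (suc j % p) ≡ sumFrom c 0 (suc j)
  partial j j<p with suc j ≟ p
  ... | yes j+1≡p = begin
    S + sumFrom c 0 (suc j % p)  ≡⟨ cong (λ q → S + sumFrom c 0 (q % p)) j+1≡p ⟩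
    S + sumFrom c 0 (p % p)      ≡⟨ cong (λ q → S + sumFrom c 0 q) (n%n≡0 p) ⟩
    S + 0                        ≡⟨ +-identityʳ S ⟩
    S                            ≡⟨ cong (sumFrom c 0) (sym j+1≡p) ⟩
    sumFrom c 0 (suc j)          ∎
  ... | no  j+1≢p = cong (sumFrom c 0) (m<n⇒m%n≡m (≤∧≢⇒< j<p j+1≢p))

canonicalPoint : (p : ℕ) → 0 < p → ℕ → Point
canonicalPoint (suc p₀) _ S = canonical p₀ S , (0 , zero)

canonicalPoint-unroll : ∀ q₀ p₀ S →
  canonicalPoint (suc p₀) z<s S ∼ canonicalPoint (suc q₀ * suc p₀) z<s (suc q₀ * S)
canonicalPoint-unroll q₀ p₀ S =
  ∼-trans (∼-sym (∼-hom (cycle (p₀ + q₀ * suc p₀) unrolled) (canonical p₀ S) (unrollHom q₀ p₀ c) (0 , zero)))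
    (∼-trans (∼-sym (∼-hom _ _ (canonicalHom _ unrolled) (0 , zero))) (≡⇒∼ (cong (canonicalPoint _ z<s) total)))
  where
  c = atLast (suc p₀) S
  unrolled = λ j → c (j % suc p₀)
  total : sumFrom unrolled 0 (suc q₀ * suc p₀) ≡ suc q₀ * S
  total = trans (sumFrom-periodic unrolled (periodic (canonicalStream p₀ S)) z≤n (suc q₀))
                (cong (suc q₀ *_) (periodSum-canonicalStream p₀ S))

canonicalPoint-resp : ∀ p q (p>0 : 0 < p) (q>0 : 0 < q) S T →
  q * S ≡ p * T → canonicalPoint p p>0 S ∼ canonicalPoint q q>0 T
canonicalPoint-resp (suc p₀) (suc q₀) _ _ S T q*S≡p*T =
  ∼-trans (canonicalPoint-unroll q₀ p₀ S)
    (∼-trans (≡⇒∼ (cong₂ (λ N₀ R → canonicalPoint (suc N₀) z<s R) (suc-injective (*-comm (suc q₀) (suc p₀))) q*S≡p*T))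
      (∼-sym (canonicalPoint-unroll p₀ q₀ T)))

canonicalPointOf : EPStream → Point
canonicalPointOf e = canonicalPoint (per e) (per>0 e) (periodSum e)

canonicalPointOf-resp : ∀ {e e′} → e ≈E e′ → canonicalPointOf e ∼ canonicalPointOf e′
canonicalPointOf-resp {e} {e′} = canonicalPoint-resp (per e) (per e′) (per>0 e) (per>0 e′) _ _

sharp-canonicalPoint : ∀ p (p>0 : 0 < p) S e → per e ≡ p → periodSum e ≡ S →
  sharp′ (canonicalPoint p p>0 S) ≈E e
sharp-canonicalPoint (suc p₀) _ S e per≡ sum≡ =
  ≈E-trans {sharp (canonical p₀ S) (0 , zero)} {canonicalStream p₀ S} {e} (sharp-cycle p₀ (atLast (suc p₀) S) 0)
    (≈E-per-periodSum {canonicalStream p₀ S} {e} (sym per≡) (trans (periodSum-canonicalStream p₀ S) (sym sum≡)))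

sharp-canonicalPointOf : ∀ e → sharp′ (canonicalPointOf e) ≈E e
sharp-canonicalPointOf e = sharp-canonicalPoint (per e) (per>0 e) (periodSum e) e refl refl

canonicalPointOf-≈E : ∀ e p (p>0 : 0 < p) S → e ≈E sharp′ (canonicalPoint p p>0 S) →
  canonicalPointOf e ∼ canonicalPoint p p>0 S
canonicalPointOf-≈E e (suc p₀) p>0 S e≈canonical =
  canonicalPoint-resp (per e) (suc p₀) (per>0 e) p>0 (periodSum e) S
    (trans (≈E-trans {e} {sharp (canonical p₀ S) (0 , zero)} {canonicalStream p₀ S} e≈canonical (sharp-cycle p₀ (atLast (suc p₀) S) 0))
           (cong (per e *_) (periodSum-canonicalStream p₀ S)))

-- Reduce to level 0, run into the periodic part of the orbit, which is the
-- image of a cycle, and replace that cycle by the canonical one.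
∼-canonicalPoint : ∀ x → Σ ℕ λ p₀ → Σ ℕ λ S → x ∼ canonicalPoint (suc p₀) z<s S
∼-canonicalPoint ((n , γ , γ-hom) , (m , y)) with iter-eventuallyPeriodic (nextG γ) y
... | K , zero   , () , _
... | K , suc P₀ , _  , periodic = P₀ , sumFrom c 0 (suc P₀) ,
  ∼-trans (∼-drop o m y) (∼-trans (∼-iter K y)
    (∼-trans (∼-sym (∼-hom (cycle P₀ c) o (orbitHom γ-hom y K P₀ periodic) (0 , zero)))
      (∼-sym (∼-hom _ _ (canonicalHom P₀ c) (0 , zero)))))
  where
  o = (n , γ , γ-hom)
  c = λ j → genStream γ y (K + j)

canonicalPointOf-sharp : ∀ x → canonicalPointOf (sharp′ x) ∼ x
canonicalPointOf-sharp x with ∼-canonicalPoint x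
... | p₀ , S , x∼canonical =
  ∼-trans (canonicalPointOf-≈E (sharp′ x) (suc p₀) z<s S (sharp-∼ x∼canonical)) (∼-sym x∼canonical)

module Universal {B : Set} (uB cB : B → B) (f : (o : Obj) → Car o → B)
  (f-hom : (o : Obj) → IsUHom uT uB (f o) × (∀ t → f o (str o t) ≡ cB (f o t)))
  (f-cocone : (o o′ : Obj) (h : Hom o o′) → ∀ t → f o′ (proj₁ h t) ≡ f o t) where

  f′ : Point → B
  f′ (o , t) = f o t

  f-∼ : ∀ {x y} → x ∼ y → f′ x ≡ f′ y
  f-∼ = gfold isEquivalence f′ λ { (along {o} {o′} {t} h) → sym (f-cocone o o′ h t) }

  mediating : EPStream → B
  mediating e = f′ (canonicalPointOf e)

  f′-fixed-uB : ∀ x → f′ x ≡ uB (f′ x)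
  f′-fixed-uB (o , t) = trans (f-∼ (∼-hom o o (uT-hom o) t)) (proj₁ (f-hom o) t)

  f′-fixed-cB : ∀ x → f′ x ≡ cB (f′ x)
  f′-fixed-cB (o , t) = trans (f-∼ (∼-hom o o (str-hom o) t)) (proj₂ (f-hom o) t)

  mediating-sharp : (o : Obj) → ∀ t → mediating (sharp o t) ≡ f o t
  mediating-sharp o t = f-∼ (canonicalPointOf-sharp (o , t))

  mediating-unique : (k : EPStream → B) → (∀ e e′ → e ≈E e′ → k e ≡ k e′) →
    ((o : Obj) → ∀ t → k (sharp o t) ≡ f o t) → ∀ e → k e ≡ mediating e
  mediating-unique k k-resp k-sharp e =
    trans (k-resp e _ (sym (sharp-canonicalPointOf e))) (k-sharp _ _)

mainTheorem9 :
    -- each γ♯ is a morphism of Id-coalgebras in C into (E , id_E , id_E)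
    ((o : Obj) → (t : Car o) →
        (sharp o (uT t) ≈E uE (sharp o t)) × (sharp o (str o t) ≈E cE (sharp o t)))
    -- the γ♯ form a cocone over the diagram
    × ((o o′ : Obj) → (h : Hom o o′) → (t : Car o) →
        sharp o′ (Σ.proj₁ h t) ≈E sharp o t)
    -- universality: every cocone factors uniquely through E
    × ((B : Set) → (uB : B → B) → (cB : B → B) → IsUHom uB uB cB →
       (f : (o : Obj) → Car o → B) →
       ((o : Obj) → IsUHom uT uB (f o) × (∀ t → f o (str o t) ≡ cB (f o t))) →
       ((o o′ : Obj) → (h : Hom o o′) → ∀ t → f o′ (Σ.proj₁ h t) ≡ f o t) →
       Σ (EPStream → B) λ k →
         (∀ e e′ → e ≈E e′ → k e ≡ k e′)
         × IsUHom uE uB k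
         × (∀ e → k (cE e) ≡ cB (k e))
         × ((o : Obj) → ∀ t → k (sharp o t) ≡ f o t)
         × ((k′ : EPStream → B) →
              (∀ e e′ → e ≈E e′ → k′ e ≡ k′ e′) →
              IsUHom uE uB k′ →
              (∀ e → k′ (cE e) ≡ cB (k′ e)) →
              ((o : Obj) → ∀ t → k′ (sharp o t) ≡ f o t) →
              ∀ e → k′ e ≡ k e))
mainTheorem9 =
  (λ o t → refl , sharp-hom o o (str-hom o) t) ,
  sharp-hom ,
  λ B uB cB _ f f-hom f-cocone → let open Universal uB cB f f-hom f-cocone in
    mediating ,
    (λ e e′ e≈e′ → f-∼ (canonicalPointOf-resp {e} {e′} e≈e′)) ,
    (λ e → f′-fixed-uB (canonicalPointOf e)) ,
    (λ e → f′-fixed-cB (canonicalPointOf e)) ,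
    mediating-sharp ,
    λ k k-resp _ _ k-sharp → mediating-unique k k-resp k-sharp
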